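{- Consider the three two-vertex Boolean networks $(f_1,f_2)$: $[1,00,01,10]$: $f_1=x_1\land\neg x_2,f_2=\neg x_1\land x_2$; $[2,00,01,10]$: $f_1=x_1\land\neg x_2,f_2=x_2$; $[3,00,01,10]$: $f_1=x_1,f_2=\neg x_1\land x_2$. For any delay vector $(\alpha,\beta)$, every MBN built on one of these networks has exactly three attractors, the fixed points $(0,0)$, $(0,\beta)$ and $(\alpha,0)$.
   Context: The MBN built on a two-vertex Boolean network $(f_1,f_2)$ with delay vector $(\alpha,\beta)$ of positive integers has configurations $(\rho,\gamma)$ with $0\le\rho\le\alpha$, $0\le\gamma\le\beta$, underlying Boolean state $x=([\rho\ge1],[\gamma\ge1])$, and dynamics: the first coordinate becomes $\alpha$ if $f_1(x)=1$, else $\max(\rho-1,0)$; the second becomes $\beta$ if $f_2(x)=1$, else $\max(\gamma-1,0)$. Attractors are periodic orbits: fixed points (length 1) and limit cycles (length $\ge2$). -}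

module Defs where

open import Data.Bool using (Bool; true; false; not; _∧_)
open import Data.Nat using (ℕ; zero; suc; _≤_; _∸_; _≤ᵇ_)
open import Data.Product using (_×_; _,_; Σ; ∃-syntax)
open import Relation.Binary.PropositionalEquality using (_≡_)

BN2 : Set
BN2 = (Bool → Bool → Bool) × (Bool → Bool → Bool)

net1 net2 net3 : BN2
net1 = (λ x₁ x₂ → x₁ ∧ not x₂) , (λ x₁ x₂ → not x₁ ∧ x₂)
net2 = (λ x₁ x₂ → x₁ ∧ not x₂) , (λ x₁ x₂ → x₂)
net3 = (λ x₁ x₂ → x₁) , (λ x₁ x₂ → not x₁ ∧ x₂)

Config : Set
Config = ℕ × ℕ

Valid : ℕ → ℕ → Config → Set
Valid α β (ρ , γ) = (ρ ≤ α) × (γ ≤ β)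

pos : ℕ → Bool
pos zero = false
pos (suc _) = true

-- One MBN update step. Note max(ρ-1,0) = ρ ∸ 1 on ℕ.
step : BN2 → ℕ → ℕ → Config → Config
step (f₁ , f₂) α β (ρ , γ) =
  (if1 (f₁ (pos ρ) (pos γ)) α (ρ ∸ 1)) , (if1 (f₂ (pos ρ) (pos γ)) β (γ ∸ 1))
  where
  if1 : Bool → ℕ → ℕ → ℕ
  if1 true  a _ = a
  if1 false _ b = b

iterate : (Config → Config) → ℕ → Config → Config
iterate F zero c = c
iterate F (suc n) c = F (iterate F n c)

IsPeriodic : BN2 → ℕ → ℕ → Config → Set
IsPeriodic N α β c = ∃[ p ] (iterate (step N α β) (suc p) c ≡ c)

IsFixed : BN2 → ℕ → ℕ → Config → Set
IsFixed N α β c = step N α β c ≡ c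

-- Since attractors are the orbits of
-- periodic configurations, this says the attractors are precisely these three
-- singleton orbits (pairwise distinct as α, β ≥ 1), i.e. no limit cycles.
data IsOneOfThree (α β : ℕ) : Config → Set where
  c00 : IsOneOfThree α β (0 , 0)
  c0β : IsOneOfThree α β (0 , β)
  cα0 : IsOneOfThree α β (α , 0)

ExactlyThreeFixedAttractors : BN2 → ℕ → ℕ → Set
ExactlyThreeFixedAttractors N α β =
  (∀ c → IsOneOfThree α β c → Valid α β c × IsFixed N α β c)
  × (∀ c → Valid α β c → IsPeriodic N α β c → IsOneOfThree α β c)

data IsListedNet : BN2 → Set where
  n1 : IsListedNet net1
  n2 : IsListedNet net2
  n3 : IsListedNet net3

{-# OPTIONS --safe #-}
module Submission where

-- Along each axis a vertex keeps itself active while the other one stays silent, so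
-- (ρ , 0) with ρ ≥ 1 jumps to (α , 0), (0 , γ) with γ ≥ 1 jumps to (0 , β), and
-- (0 , 0) stays put. In the interior at least one vertex is switched off, so its
-- counter decreases. The potential that is 2 + (that counter) in the interior, and
-- off the interior 0 at the three fixed points and 1 elsewhere, therefore strictly
-- decreases at every non-fixed configuration; hence every periodic configuration is
-- fixed, and a fixed configuration cannot lie in the interior.

open import Defs
open import Data.Bool using (true; false)
open import Data.Bool.Properties using (∧-identityʳ)
open import Data.Empty using (⊥-elim)
open import Data.Nat using (ℕ; zero; suc; _+_; _≤_; _<_; _≥_; z≤n; s≤s; _≟_)
open import Data.Nat.Properties
  using (≤-refl; ≤-trans; <⇒≤; ≤-reflexive; <-irrefl; <-≤-trans; m≤m+n; n<1+n)
open import Data.Product using (_×_; _,_; proj₁; proj₂)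
open import Data.Sum using (_⊎_; inj₁; inj₂)
open import Relation.Nullary using (yes; no; contradiction)
open import Relation.Binary.PropositionalEquality using (_≡_; refl; sym; trans; cong; subst)

Descends : (Config → Config) → (Config → ℕ) → Set
Descends F W = ∀ c → F c ≡ c ⊎ W (F c) < W c

module _ {F : Config → Config} {W : Config → ℕ} (descends : Descends F W) where

  W-step-≤ : ∀ c → W (F c) ≤ W c
  W-step-≤ c with descends c
  ... | inj₁ Fc≡c = ≤-reflexive (cong W Fc≡c)
  ... | inj₂ W-< = <⇒≤ W-<

  W-iterate-≤ : ∀ k c → W (iterate F (suc k) c) ≤ W (F c)
  W-iterate-≤ zero    c = ≤-refl
  W-iterate-≤ (suc k) c = ≤-trans (W-step-≤ (iterate F (suc k) c)) (W-iterate-≤ k c)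

  periodic⇒fixed : ∀ p c → iterate F (suc p) c ≡ c → F c ≡ c
  periodic⇒fixed p c periodic with descends c
  ... | inj₁ Fc≡c = Fc≡c
  ... | inj₂ W-< = ⊥-elim (<-irrefl refl
          (<-≤-trans W-< (subst (λ x → W x ≤ W (F c)) periodic (W-iterate-≤ p c))))

mismatch : ℕ → ℕ → ℕ
mismatch m n with m ≟ n
... | yes _ = 0
... | no  _ = 1

mismatch-refl : ∀ n → mismatch n n ≡ 0
mismatch-refl n with n ≟ n
... | yes _   = refl
... | no  n≢n = contradiction refl n≢n

mismatch≤1 : ∀ m n → mismatch m n ≤ 1
mismatch≤1 m n with m ≟ n
... | yes _ = z≤n
... | no  _ = s≤s z≤n

mismatch-positive : ∀ m n → m ≡ n ⊎ 0 < mismatch m n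
mismatch-positive m n with m ≟ n
... | yes m≡n = inj₁ m≡n
... | no  _   = inj₂ (s≤s z≤n)

record AxisSustained (N : BN2) : Set where
  field
    f₁-axis        : ∀ x → proj₁ N x false ≡ x
    f₁-silenced    : proj₁ N false true ≡ false
    f₂-axis        : ∀ y → proj₂ N false y ≡ y
    f₂-silenced    : proj₂ N true false ≡ false
    interior-decay : proj₁ N true true ≡ false ⊎ proj₂ N true true ≡ false

listed⇒axisSustained : ∀ {N} → IsListedNet N → AxisSustained N
listed⇒axisSustained n1 = record
  { f₁-axis = ∧-identityʳ ; f₁-silenced = refl ; f₂-axis = λ _ → refl
  ; f₂-silenced = refl ; interior-decay = inj₁ refl }
listed⇒axisSustained n2 = record
  { f₁-axis = ∧-identityʳ ; f₁-silenced = refl ; f₂-axis = λ _ → refl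
  ; f₂-silenced = refl ; interior-decay = inj₁ refl }
listed⇒axisSustained n3 = record
  { f₁-axis = λ _ → refl ; f₁-silenced = refl ; f₂-axis = λ _ → refl
  ; f₂-silenced = refl ; interior-decay = inj₂ refl }

module _ {N : BN2} (sustained : AxisSustained N) (a b : ℕ) where
  open AxisSustained sustained

  private
    α β : ℕ
    α = suc a
    β = suc b

    F : Config → Config
    F = step N α β

  step-origin : F (0 , 0) ≡ (0 , 0)
  step-origin rewrite f₁-axis false | f₂-axis false = refl

  step-axis₁ : ∀ r → F (suc r , 0) ≡ (α , 0)
  step-axis₁ r rewrite f₁-axis true | f₂-silenced = refl

  step-axis₂ : ∀ g → F (0 , suc g) ≡ (0 , β)
  step-axis₂ g rewrite f₁-silenced | f₂-axis true = refl

  decaying : Config → ℕ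
  decaying with interior-decay
  ... | inj₁ _ = proj₁
  ... | inj₂ _ = proj₂

  decaying-step-< : ∀ r g → decaying (F (suc r , suc g)) < decaying (suc r , suc g)
  decaying-step-< r g with interior-decay
  ... | inj₁ f₁-off rewrite f₁-off = n<1+n r
  ... | inj₂ f₂-off rewrite f₂-off = n<1+n g

  potential : Config → ℕ
  potential (zero  , zero ) = 0
  potential (suc r , zero ) = mismatch (suc r) α
  potential (zero  , suc g) = mismatch (suc g) β
  potential c@(suc _ , suc _) = 2 + decaying c

  potential<2+ : ∀ c k → decaying c < k → potential c < 2 + k
  potential<2+ (zero  , zero ) k _ = s≤s z≤n
  potential<2+ (suc r , zero ) k _ = <-≤-trans (s≤s (mismatch≤1 (suc r) α)) (m≤m+n 2 k)
  potential<2+ (zero  , suc g) k _ = <-≤-trans (s≤s (mismatch≤1 (suc g) β)) (m≤m+n 2 k)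
  potential<2+ (suc _ , suc _) k d< = s≤s (s≤s d<)

  potential-descends : Descends F potential
  potential-descends (zero , zero) = inj₁ step-origin
  potential-descends (suc r , zero) with mismatch-positive (suc r) α
  ... | inj₁ r+1≡α = inj₁ (trans (step-axis₁ r) (cong (_, 0) (sym r+1≡α)))
  ... | inj₂ 0<mismatch rewrite step-axis₁ r | mismatch-refl α = inj₂ 0<mismatch
  potential-descends (zero , suc g) with mismatch-positive (suc g) β
  ... | inj₁ g+1≡β = inj₁ (trans (step-axis₂ g) (cong (0 ,_) (sym g+1≡β)))
  ... | inj₂ 0<mismatch rewrite step-axis₂ g | mismatch-refl β = inj₂ 0<mismatch
  potential-descends (suc r , suc g) =
    inj₂ (potential<2+ (F (suc r , suc g)) (decaying (suc r , suc g)) (decaying-step-< r g))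

  fixed⇒oneOfThree : ∀ c → F c ≡ c → IsOneOfThree α β c
  fixed⇒oneOfThree (zero  , zero ) _     = c00
  fixed⇒oneOfThree (suc r , zero ) fixed = subst (IsOneOfThree α β) (trans (sym (step-axis₁ r)) fixed) cα0
  fixed⇒oneOfThree (zero  , suc g) fixed = subst (IsOneOfThree α β) (trans (sym (step-axis₂ g)) fixed) c0β
  fixed⇒oneOfThree (suc r , suc g) fixed = ⊥-elim (<-irrefl (cong decaying fixed) (decaying-step-< r g))

  oneOfThree⇒validFixed : ∀ c → IsOneOfThree α β c → Valid α β c × IsFixed N α β c
  oneOfThree⇒validFixed _ c00 = (z≤n , z≤n) , step-origin
  oneOfThree⇒validFixed _ c0β = (z≤n , ≤-refl) , step-axis₂ b
  oneOfThree⇒validFixed _ cα0 = (≤-refl , z≤n) , step-axis₁ a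

  axisSustained⇒exactlyThreeFixedAttractors : ExactlyThreeFixedAttractors N α β
  axisSustained⇒exactlyThreeFixedAttractors =
    oneOfThree⇒validFixed ,
    λ c _ (p , periodic) → fixed⇒oneOfThree c (periodic⇒fixed potential-descends p c periodic)

proposition18 : (N : BN2) → IsListedNet N → (α β : ℕ) → α ≥ 1 → β ≥ 1 →
    ExactlyThreeFixedAttractors N α β
proposition18 N listed (suc a) (suc b) _ _ =
  axisSustained⇒exactlyThreeFixedAttractors (listed⇒axisSustained listed) a b
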